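{- Let $\Gamma$ be a complete multipartite graph on vertex set $V$ with $|V|=n-1$, and let $C=K_I$ be a clique of the complete graph $K_{n-1}$ on $V$, $I\subseteq V$. Then either $\operatorname{rk}(C)=\operatorname{rk}(C\cap E(\Gamma))$ or $\operatorname{rk}(C\cap E(\Gamma))=0$.
   Context: A complete multipartite graph is one whose vertex set is partitioned into independent sets with two vertices adjacent iff they lie in different parts. $K_I$ denotes the complete graph on vertex set $I$ (a clique). The rank of an edge set is its rank in the cycle matroid: the number of edges of a spanning forest, equivalently the number of non-isolated vertices minus the number of connected components among them. $C\cap E(\Gamma)$ denotes the subgraph of $C$ with edges those of $C$ lying in $\Gamma$ (the projection $\pi_\Gamma(C)$). -}

module Defs where

open import Data.Nat using (ℕ; zero; suc; _∸_; _+_)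
open import Data.Bool using (Bool; true; false; _∧_; _∨_; not; if_then_else_)
open import Data.Fin using (Fin; _<?_)
open import Data.Fin.Subset using (Subset)
open import Data.Fin.Subset.Properties using (_∈?_)
open import Data.List using (List; map)
open import Data.Nat.ListAction using (sum)
open import Data.Bool.ListAction using (any)
open import Data.List.Base using (allFin)
open import Relation.Nullary.Decidable using (⌊_⌋)
open import Data.Fin.Properties using (_≟_)

-- An edge set on the vertex set Fin m: a (symmetric, loopless) Boolean
-- adjacency relation; the edge {i,j} is present iff E i j ≡ true.
EdgeSet : ℕ → Set
EdgeSet m = Fin m → Fin m → Bool

clique : ∀ {m} → Subset m → EdgeSet m
clique I i j = ⌊ i ∈? I ⌋ ∧ ⌊ j ∈? I ⌋ ∧ not ⌊ i ≟ j ⌋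

-- The complete multipartite graph with parts given by a labelling
-- part : Fin m → Fin k (vertices with the same label form one part):
-- i and j are adjacent iff they lie in different parts.
completeMultipartite : ∀ {m k} → (Fin m → Fin k) → EdgeSet m
completeMultipartite part i j = not ⌊ part i ≟ part j ⌋

_∩E_ : ∀ {m} → EdgeSet m → EdgeSet m → EdgeSet m
(C ∩E Γ) i j = C i j ∧ Γ i j

count : ∀ {m} → (Fin m → Bool) → ℕ
count {m} p = sum (map (λ i → if p i then 1 else 0) (allFin m))

reachWithin : ∀ {m} → EdgeSet m → ℕ → Fin m → Fin m → Bool
reachWithin E zero i j = ⌊ i ≟ j ⌋
reachWithin {m} E (suc k) i j =
  reachWithin E k i j ∨ any (λ l → reachWithin E k i l ∧ E l j) (allFin m)

-- connected by a path in E (paths of length ≤ m suffice)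
connected : ∀ {m} → EdgeSet m → Fin m → Fin m → Bool
connected {m} E = reachWithin E m

nonIsolated : ∀ {m} → EdgeSet m → Fin m → Bool
nonIsolated {m} E v = any (λ u → E v u) (allFin m)

numNonIsolated : ∀ {m} → EdgeSet m → ℕ
numNonIsolated E = count (nonIsolated E)

-- number of connected components among the non-isolated vertices:
-- each component is counted once, via its least vertex
numComponents : ∀ {m} → EdgeSet m → ℕ
numComponents {m} E =
  count (λ v → nonIsolated E v ∧
               not (any (λ u → ⌊ u <? v ⌋ ∧ connected E u v) (allFin m)))

-- rank in the cycle matroid:
-- (#non-isolated vertices) − (#components among them)
rk : ∀ {m} → EdgeSet m → ℕ
rk E = numNonIsolated E ∸ numComponents E

module Submission where

-- Let C = K_I and P = C ∩ E(Γ), where Γ is complete multipartite.  Either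
-- all vertices of I lie in one part of Γ, and then P has no edges, so its
-- rank is 0; or two vertices a, b ∈ I lie in different parts.  In the
-- latter case every vertex of I has a P-neighbour in I (a or b), and any
-- two vertices of I are joined by a P-path of length at most 2.  Hence C
-- and P have the same non-isolated vertices (exactly I, when |I| ≥ 2) and
-- the same connectivity among them, so they have the same rank.

open import Defs
open import Data.Nat using (ℕ; zero; suc; _∸_; _≤_; _≤′_; ≤′-refl; ≤′-step; z≤n; s≤s)
open import Data.Nat.Properties using (0∸n≡0; ≤⇒≤′)
open import Data.Bool using (Bool; true; false; T; _∧_; not; if_then_else_)
open import Data.Bool.Properties using (T-∧; T-∨)
open import Data.Bool.ListAction using (any; or)
open import Data.Fin using (Fin; zero; suc; _<?_)
open import Data.Fin.Subset using (Subset; _∈_)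
open import Data.Fin.Subset.Properties using (_∈?_)
open import Data.Fin.Properties using (_≟_; any?)
open import Data.List using (List; []; _∷_; map; allFin)
open import Data.List.Properties using (map-cong)
open import Data.List.Membership.Propositional using (lose)
open import Data.List.Membership.Propositional.Properties using (∈-allFin)
open import Data.List.Relation.Unary.Any using (satisfied)
open import Data.List.Relation.Unary.Any.Properties using (any⁺; any⁻)
open import Data.Nat.ListAction using (sum)
open import Data.Product using (∃-syntax; _×_; _,_; proj₂)
open import Data.Sum using (_⊎_; inj₁; inj₂)
open import Data.Unit using (tt)
open import Function.Bundles using (Equivalence)
open import Relation.Nullary using (¬_; contradiction)
open import Relation.Nullary.Decidable using (Dec; yes; no; ¬?; _×-dec_; ⌊_⌋; toWitness; fromWitness)
open import Relation.Binary.PropositionalEquality using (_≡_; _≢_; refl; sym; trans; cong; cong₂)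

open Equivalence using (to; from)

T-ext : ∀ {a b : Bool} → (T a → T b) → (T b → T a) → a ≡ b
T-ext {false} {false} _ _ = refl
T-ext {false} {true}  _ g = contradiction tt g
T-ext {true}  {false} f _ = contradiction tt f
T-ext {true}  {true}  _ _ = refl

∧-cong-guarded : ∀ {a a′ b b′ : Bool} → a ≡ a′ → (T a → b ≡ b′) → a ∧ b ≡ a′ ∧ b′
∧-cong-guarded {false} refl _ = refl
∧-cong-guarded {true}  refl h = h tt

∧-intro : ∀ {a b : Bool} → T a → T b → T (a ∧ b)
∧-intro ta tb = from T-∧ (ta , tb)

module _ {m : ℕ} (p : Fin m → Bool) where

  any-intro : ∀ x → T (p x) → T (any p (allFin m))
  any-intro x px = any⁺ p (lose (∈-allFin x) px)

  any-elim : T (any p (allFin m)) → ∃[ x ] T (p x)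
  any-elim t = satisfied (any⁻ p (allFin m) t)

count-cong : ∀ {m} {p q : Fin m → Bool} → (∀ x → p x ≡ q x) → count p ≡ count q
count-cong {m} p≗q =
  cong sum (map-cong (λ x → cong (λ b → if b then 1 else 0) (p≗q x)) (allFin m))

count-empty : ∀ {m} (p : Fin m → Bool) → (∀ x → ¬ T (p x)) → count p ≡ 0
count-empty {m} p ¬p = go (allFin m)
  where
  go : (xs : List (Fin m)) → sum (map (λ i → if p i then 1 else 0) xs) ≡ 0
  go []       = refl
  go (x ∷ xs) with p x | ¬p x
  ... | true  | ¬t = contradiction tt ¬t
  ... | false | _  = go xs

_⊆ᴱ_ : ∀ {m} → EdgeSet m → EdgeSet m → Set
E ⊆ᴱ F = ∀ i j → T (E i j) → T (F i j)

module _ {m : ℕ} (E : EdgeSet m) where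

  nonIsolated-intro : ∀ v w → T (E v w) → T (nonIsolated E v)
  nonIsolated-intro v = any-intro (E v)

  nonIsolated-elim : ∀ v → T (nonIsolated E v) → ∃[ w ] T (E v w)
  nonIsolated-elim v = any-elim (E v)

nonIsolated-mono : ∀ {m} {E F : EdgeSet m} → E ⊆ᴱ F → ∀ v → T (nonIsolated E v) → T (nonIsolated F v)
nonIsolated-mono {E = E} {F} E⊆F v t with nonIsolated-elim E v t
... | w , e = nonIsolated-intro F v w (E⊆F v w e)

module _ {m : ℕ} (E : EdgeSet m) where

  reach-refl : ∀ k i → T (reachWithin E k i i)
  reach-refl zero    i = fromWitness refl
  reach-refl (suc k) i = from T-∨ (inj₁ (reach-refl k i))

  reach-step : ∀ {k i l j} → T (reachWithin E k i l) → T (E l j) → T (reachWithin E (suc k) i j)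
  reach-step {k} {i} {l} {j} r e =
    from T-∨ (inj₂ (any-intro (λ l → reachWithin E k i l ∧ E l j) l (∧-intro r e)))

  reach-lengthen : ∀ {k k′ i j} → k ≤′ k′ → T (reachWithin E k i j) → T (reachWithin E k′ i j)
  reach-lengthen ≤′-refl        r = r
  reach-lengthen (≤′-step k≤k′) r = from T-∨ (inj₁ (reach-lengthen k≤k′ r))

  reach-last : ∀ {k i j} → T (reachWithin E (suc k) i j) →
               T (reachWithin E k i j) ⊎ ∃[ l ] (T (reachWithin E k i l) × T (E l j))
  reach-last {k} {i} {j} r with to T-∨ r
  ... | inj₁ shorter = inj₁ shorter
  ... | inj₂ t with any-elim (λ l → reachWithin E k i l ∧ E l j) t
  ...   | l , rl∧e = inj₂ (l , to T-∧ rl∧e)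

  reach-source : (S : Fin m → Set) → (∀ u w → T (E u w) → S u) →
                 ∀ k {u v} → T (reachWithin E k u v) → u ≡ v ⊎ S u
  reach-source S tail zero    r = inj₁ (toWitness r)
  reach-source S tail (suc k) {u} {v} r with reach-last {k} {u} {v} r
  ... | inj₁ shorter = reach-source S tail k shorter
  ... | inj₂ (l , r′ , e) with reach-source S tail k {u} {l} r′
  ...   | inj₁ refl = inj₂ (tail l v e)
  ...   | inj₂ Su   = inj₂ Su

reach-mono : ∀ {m} {E F : EdgeSet m} → E ⊆ᴱ F → ∀ k {i j} →
             T (reachWithin E k i j) → T (reachWithin F k i j)
reach-mono E⊆F zero    r = r
reach-mono {E = E} {F} E⊆F (suc k) {i} {j} r with reach-last E {k} {i} {j} r
... | inj₁ shorter      = from T-∨ (inj₁ (reach-mono E⊆F k {i} {j} shorter))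
... | inj₂ (l , r′ , e) = reach-step F {k} {i} {l} {j} (reach-mono E⊆F k {i} {l} r′) (E⊆F l j e)

rk-cong : ∀ {m} (E F : EdgeSet m) →
          (∀ v → nonIsolated E v ≡ nonIsolated F v) →
          (∀ u v → T (nonIsolated E v) → connected E u v ≡ connected F u v) →
          rk E ≡ rk F
rk-cong {m} E F same-non same-conn =
  cong₂ _∸_ (count-cong same-non)
            (count-cong λ v → ∧-cong-guarded (same-non v) (same-earlier v))
  where
  same-earlier : ∀ v → T (nonIsolated E v) →
    not (any (λ u → ⌊ u <? v ⌋ ∧ connected E u v) (allFin m))
      ≡ not (any (λ u → ⌊ u <? v ⌋ ∧ connected F u v) (allFin m))
  same-earlier v nv =
    cong (λ bs → not (or bs)) (map-cong (λ u → cong (⌊ u <? v ⌋ ∧_) (same-conn u v nv)) (allFin m))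

rk-edgeless : ∀ {m} (E : EdgeSet m) → (∀ i j → ¬ T (E i j)) → rk E ≡ 0
rk-edgeless E none =
  trans (cong (_∸ numComponents E) (count-empty (nonIsolated E) isolated)) (0∸n≡0 (numComponents E))
  where
  isolated : ∀ v → ¬ T (nonIsolated E v)
  isolated v t with nonIsolated-elim E v t
  ... | w , e = none v w e

-- Two distinct elements of Fin m force 2 ≤ m (so paths of length 2 fit
-- within the bound m used by `connected`).
distinct⇒2≤ : ∀ {m} {u v : Fin m} → u ≢ v → 2 ≤ m
distinct⇒2≤ {suc zero}    {zero} {zero} u≢v = contradiction refl u≢v
distinct⇒2≤ {suc (suc m)} _ = s≤s (s≤s z≤n)

module CliqueProjection {m k : ℕ} (part : Fin m → Fin k) (I : Subset m) where

  C : EdgeSet m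
  C = clique I

  P : EdgeSet m
  P = clique I ∩E completeMultipartite part

  clique-tail : ∀ i j → T (C i j) → i ∈ I
  clique-tail i j c with i ∈? I
  clique-tail i j c  | yes i∈I = i∈I
  clique-tail i j () | no  _

  projection⊆clique : P ⊆ᴱ C
  projection⊆clique i j p with C i j
  projection⊆clique i j p  | true = tt
  projection⊆clique i j () | false

  projection-edge : ∀ i j → i ∈ I → j ∈ I → part i ≢ part j → T (P i j)
  projection-edge i j i∈I j∈I pi≢pj with i ∈? I | j ∈? I | i ≟ j | part i ≟ part j
  ... | no i∉I | _      | _        | _         = contradiction i∈I i∉I
  ... | yes _  | no j∉I | _        | _         = contradiction j∈I j∉I
  ... | yes _  | yes _  | yes refl | _         = contradiction refl pi≢pj
  ... | yes _  | yes _  | no _     | yes pi≡pj = contradiction pi≡pj pi≢pj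
  ... | yes _  | yes _  | no _     | no _      = tt

  projection-edge⁻ : ∀ i j → T (P i j) → i ∈ I × j ∈ I × part i ≢ part j
  projection-edge⁻ i j p with i ∈? I | j ∈? I | i ≟ j | part i ≟ part j
  projection-edge⁻ i j p  | yes i∈I | yes j∈I | no _  | no pi≢pj = i∈I , j∈I , pi≢pj
  projection-edge⁻ i j () | no _    | _       | _     | _
  projection-edge⁻ i j () | yes _   | no _    | _     | _
  projection-edge⁻ i j () | yes _   | yes _   | yes _ | _
  projection-edge⁻ i j () | yes _   | yes _   | no _  | yes _

  MeetsTwoParts : Set
  MeetsTwoParts = ∃[ a ] ∃[ b ] (a ∈ I × b ∈ I × part a ≢ part b)

  meetsTwoParts? : Dec MeetsTwoParts
  meetsTwoParts? = any? λ a → any? λ b → (a ∈? I) ×-dec ((b ∈? I) ×-dec ¬? (part a ≟ part b))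

  rank-one-part : ¬ MeetsTwoParts → rk P ≡ 0
  rank-one-part one = rk-edgeless P λ i j p → one (i , j , projection-edge⁻ i j p)

  module TwoParts {a b : Fin m} (a∈I : a ∈ I) (b∈I : b ∈ I) (pa≢pb : part a ≢ part b) where

    partner : ∀ u → ∃[ w ] (w ∈ I × part u ≢ part w)
    partner u with part u ≟ part a
    ... | no  pu≢pa = a , a∈I , pu≢pa
    ... | yes pu≡pa = b , b∈I , λ pu≡pb → pa≢pb (trans (sym pu≡pa) pu≡pb)

    projection-covers : ∀ {u} → u ∈ I → T (nonIsolated P u)
    projection-covers {u} u∈I with partner u
    ... | w , w∈I , pu≢pw = nonIsolated-intro P u w (projection-edge u w u∈I w∈I pu≢pw)

    within-two : ∀ {u v} → u ∈ I → v ∈ I → T (reachWithin P 2 u v)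
    within-two {u} {v} u∈I v∈I with part u ≟ part v
    ... | no pu≢pv = reach-step P {1} {u} {u} {v} (reach-refl P 1 u) (projection-edge u v u∈I v∈I pu≢pv)
    ... | yes pu≡pv with partner u
    ...   | w , w∈I , pu≢pw =
      reach-step P {1} {u} {w} {v}
        (reach-step P {0} {u} {u} {w} (reach-refl P 0 u) (projection-edge u w u∈I w∈I pu≢pw))
        (projection-edge w v w∈I v∈I λ pw≡pv → pu≢pw (trans pu≡pv (sym pw≡pv)))

    projection-connects : ∀ {u v} → u ∈ I → v ∈ I → T (connected P u v)
    projection-connects {u} {v} u∈I v∈I =
      reach-lengthen P {2} {m} {u} {v} (≤⇒≤′ (distinct⇒2≤ (λ a≡b → pa≢pb (cong part a≡b))))
                     (within-two u∈I v∈I)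

    same-nonIsolated : ∀ v → nonIsolated C v ≡ nonIsolated P v
    same-nonIsolated v =
      T-ext (λ t → projection-covers (clique-tail v _ (proj₂ (nonIsolated-elim C v t))))
            (nonIsolated-mono projection⊆clique v)

    -- A C-path into v ∈ I starts at v or in I, where P connects as well.
    same-connected : ∀ u v → T (nonIsolated C v) → connected C u v ≡ connected P u v
    same-connected u v nv = T-ext from-clique (reach-mono projection⊆clique m {u} {v})
      where
      v∈I : v ∈ I
      v∈I = clique-tail v _ (proj₂ (nonIsolated-elim C v nv))
      from-clique : T (connected C u v) → T (connected P u v)
      from-clique c with reach-source C (_∈ I) clique-tail m {u} {v} c
      ... | inj₁ refl = reach-refl P m u
      ... | inj₂ u∈I  = projection-connects u∈I v∈I

    rank-equal : rk C ≡ rk P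
    rank-equal = rk-cong C P same-nonIsolated same-connected

lemma3p26 : (m k : ℕ) (part : Fin m → Fin k) (I : Subset m) →
    rk (clique I) ≡ rk (clique I ∩E completeMultipartite part)
      ⊎ rk (clique I ∩E completeMultipartite part) ≡ 0
lemma3p26 m k part I with CliqueProjection.meetsTwoParts? part I
... | yes (a , b , a∈I , b∈I , pa≢pb) =
  inj₁ (CliqueProjection.TwoParts.rank-equal part I a∈I b∈I pa≢pb)
... | no one-part = inj₂ (CliqueProjection.rank-one-part part I one-part)
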